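{- Let $p$ be a prime and $k$ a positive integer such that for every $k$-element subset $\mathcal{K}\subset\mathbb{Z}_p$, every element of $\mathbb{Z}_p$ is the sum of the elements of some subset of $\mathcal{K}$. Let $q=mp$ with $m>1$ an integer, and let $\mathcal{B}\subset\mathbb{Z}_q$ with $|\mathcal{B}|>4k$, the elements of $\mathcal{B}$ pairwise distinct modulo $p$, and not all elements of $\mathcal{B}$ multiples of $m$. Suppose in addition that there is no subset $\mathcal{A}\subset\mathcal{B}$ with $\Sigma(\mathcal{A})\equiv 0\pmod p$ and $\Sigma(\mathcal{A})\not\equiv0\pmod q$. Let $f:\mathbb{Z}_p\to\mathbb{Z}_q$ be a map such that for every $x\in\mathbb{Z}_p$ and every $\mathcal{V}\subset\mathcal{B}$ with $|\mathcal{V}|\le k$ and $\Sigma(\mathcal{V})\equiv x\pmod p$ one has $\Sigma(\mathcal{V})\equiv f(x)\pmod q$. Then $f$ is a group homomorphism between the additive groups $\mathbb{Z}_p$ and $\mathbb{Z}_q$.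
   Context: $\mathbb{Z}_q=\mathbb{Z}/q\mathbb{Z}$; reduction modulo $p$ is the natural map $\mathbb{Z}_q\to\mathbb{Z}_p$. For a finite set $\mathcal{A}$, $\Sigma(\mathcal{A})=\sum_{a\in\mathcal{A}}a$. -}

module Defs where

open import Data.Nat using (ℕ; zero; suc; NonZero; _%_)
open import Data.Nat.DivMod using (m%n<n)
open import Data.Nat.ListAction using (sum)
open import Data.Fin using (Fin; toℕ; fromℕ<)
open import Data.Fin.Subset using (Subset; Side)
open import Data.Bool using (true; false)
open import Data.List using (List; []; _∷_; map)
open import Data.Vec using ([]; _∷_)

-- ℤ_n represented as Fin n.  Canonical residue of a natural number.
[_]_ : (n : ℕ) → .{{NonZero n}} → ℕ → Fin n
([ n ] a) = fromℕ< (m%n<n a n)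

_+[_]_ : ∀ {n} → Fin n → (n' : ℕ) → .{{NonZero n'}} → Fin n → Fin n'
x +[ n ] y = [ n ] (toℕ x Data.Nat.+ toℕ y)

-- reduction modulo p : ℤ_q → ℤ_p  (natural map when p ∣ q)
red : ∀ {q} → (p : ℕ) → .{{NonZero p}} → Fin q → Fin p
red p x = [ p ] (toℕ x)

elems : ∀ {n} → Subset n → List (Fin n)
elems [] = []
elems (true ∷ s) = Data.Fin.zero ∷ map Data.Fin.suc (elems s)
elems (false ∷ s) = map Data.Fin.suc (elems s)

Σ : ∀ {n} → .{{NonZero n}} → Subset n → Fin n
Σ {n} A = [ n ] (sum (map toℕ (elems A)))

{-# OPTIONS --safe #-}
module Submission where

-- Split B into three disjoint blocks K₁, K₂, K₃ of k elements.  Reduction mod p is injective on B,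
-- so a block maps onto a k-subset of ℤ_p, whose subset sums cover ℤ_p; pulling back, every z ∈ ℤ_p
-- is Σ V mod p for some V inside any given block, and then Σ V = f z.  If V, V′ ⊆ B avoid K₃ and
-- Σ V ≡ Σ V′ (mod p), pick W ⊆ K₃ with Σ W ≡ −Σ V (mod p): the disjoint unions V ∪ W and V′ ∪ W
-- have sums ≡ 0 (mod p), hence ≡ 0 (mod q) by the hypothesis on B, so Σ V ≡ Σ V′ (mod q).
-- Apply this to V ⊆ K₁ representing x + y and V′ = V₁ ∪ V₂, with V₁ ⊆ K₁ and V₂ ⊆ K₂
-- representing x and y.

open import Defs
open import Data.Bool using (true; false)
open import Data.Fin using (Fin; toℕ; zero; suc; _≟_)
open import Data.Fin.Properties using (toℕ-fromℕ<; toℕ-injective; suc-injective)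
open import Data.Fin.Subset using (Subset; _∈_; _∉_; _⊆_; ∣_∣; ⊥; ⁅_⁆; _∪_; _∩_)
open import Data.Fin.Subset.Properties
  using (∉⊥; ∣⊥∣≡0; x∈⁅x⁆; x∈⁅y⁆⇒x≡y; x∈p∪q⁺; x∈p∪q⁻; x∈p∩q⁺; x∈p∩q⁻; p∩q⊆p;
         ⊆-refl; ⊆-antisym; ⊆-trans; p⊆q⇒∣p∣≤∣q∣)
open import Data.List using (map)
open import Data.List.Properties using (map-∘)
open import Data.Nat using (ℕ; NonZero; _+_; _*_; _%_; pred; _≤_; _<_; s≤s)
import Data.Nat as ℕ
open import Data.Nat.DivMod using (m%n<n; %-distribˡ-+; m%n%n≡m%n; %-remove-+ʳ; m∣n⇒o%n%m≡o%m)
open import Data.Nat.Divisibility using (_∣_; divides; m%n≡0⇒n∣m; n∣m⇒m%n≡0; _∣0; m∣m*n)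
open import Data.Nat.ListAction using (sum)
open import Data.Nat.Primality using (Prime)
open import Data.Nat.Properties
  using (+-commutativeSemigroup; +-assoc; +-identityʳ; n≤1+n; +-cancelˡ-≤; m≤m+n; ≤-trans; <⇒≤;
         *-monoˡ-≤; suc-pred)
open import Algebra.Properties.CommutativeSemigroup +-commutativeSemigroup using (x∙yz≈y∙xz)
open import Data.Product using (Σ-syntax; ∃-syntax; _×_; _,_; proj₂)
open import Data.Sum using (inj₁; inj₂; [_,_]′)
open import Data.Vec using ([]; _∷_; here; there; tabulate; lookup)
open import Data.Vec.Properties using (lookup∘tabulate; []=⇒lookup; lookup⇒[]=)
open import Function using (_∘_; const)
open import Relation.Binary.PropositionalEquality
  using (_≡_; _≢_; refl; sym; trans; cong; cong₂; subst; module ≡-Reasoning)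
open import Relation.Nullary using (¬_; contradiction)
open import Relation.Nullary.Decidable using (decidable-stable)

private variable
  m n : ℕ
  A C K S : Subset n
  g h : Fin n → ℕ

sumOver : Subset n → (Fin n → ℕ) → ℕ
sumOver []          g = 0
sumOver (true  ∷ A) g = g zero + sumOver A (g ∘ suc)
sumOver (false ∷ A) g = sumOver A (g ∘ suc)

sumOver-elems      : (A : Subset n) (g : Fin n → ℕ) → sum (map g (elems A)) ≡ sumOver A g
sumOver-elems-∘suc : (A : Subset n) (g : Fin (ℕ.suc n) → ℕ) →
                     sum (map g (map suc (elems A))) ≡ sumOver A (g ∘ suc)

sumOver-elems []          g = refl
sumOver-elems (true  ∷ A) g = cong (g zero +_) (sumOver-elems-∘suc A g)
sumOver-elems (false ∷ A) g = sumOver-elems-∘suc A g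

sumOver-elems-∘suc A g = trans (cong sum (sym (map-∘ (elems A)))) (sumOver-elems A (g ∘ suc))

∣A∣≡sumOver-1 : (A : Subset n) → ∣ A ∣ ≡ sumOver A (const 1)
∣A∣≡sumOver-1 []          = refl
∣A∣≡sumOver-1 (true  ∷ A) = cong ℕ.suc (∣A∣≡sumOver-1 A)
∣A∣≡sumOver-1 (false ∷ A) = ∣A∣≡sumOver-1 A

sumOver-cong : (A : Subset n) → (∀ i → g i ≡ h i) → sumOver A g ≡ sumOver A h
sumOver-cong []          g≗h = refl
sumOver-cong (true  ∷ A) g≗h = cong₂ _+_ (g≗h zero) (sumOver-cong A (g≗h ∘ suc))
sumOver-cong (false ∷ A) g≗h = sumOver-cong A (g≗h ∘ suc)

sumOver-⊥ : (g : Fin n → ℕ) → sumOver ⊥ g ≡ 0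
sumOver-⊥ {ℕ.zero}  g = refl
sumOver-⊥ {ℕ.suc n} g = sumOver-⊥ (g ∘ suc)

sumOver-⁅⁆ : (i : Fin n) (g : Fin n → ℕ) → sumOver ⁅ i ⁆ g ≡ g i
sumOver-⁅⁆ zero    g = trans (cong (g zero +_) (sumOver-⊥ (g ∘ suc))) (+-identityʳ (g zero))
sumOver-⁅⁆ (suc i) g = sumOver-⁅⁆ i (g ∘ suc)

Disjoint : Subset n → Subset n → Set
Disjoint A C = ∀ {i} → i ∈ A → i ∉ C

Disjoint-∪ˡ : (A C : Subset n) → Disjoint A K → Disjoint C K → Disjoint (A ∪ C) K
Disjoint-∪ˡ A C A#K C#K i∈A∪C = [ A#K , C#K ]′ (x∈p∪q⁻ A C i∈A∪C)

Disjoint-tail : ∀ {a c} → Disjoint (a ∷ A) (c ∷ C) → Disjoint A C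
Disjoint-tail A#C i∈A i∈C = A#C (there i∈A) (there i∈C)

Disjoint-mono : {A′ C′ : Subset n} → A′ ⊆ A → C′ ⊆ C → Disjoint A C → Disjoint A′ C′
Disjoint-mono A′⊆A C′⊆C A#C i∈A′ i∈C′ = A#C (A′⊆A i∈A′) (C′⊆C i∈C′)

∪-least : (A C : Subset n) → A ⊆ K → C ⊆ K → A ∪ C ⊆ K
∪-least A C A⊆K C⊆K i∈A∪C = [ A⊆K , C⊆K ]′ (x∈p∪q⁻ A C i∈A∪C)

sumOver-∪ : (A C : Subset n) (g : Fin n → ℕ) →
            Disjoint A C → sumOver (A ∪ C) g ≡ sumOver A g + sumOver C g
sumOver-∪ []          []          g A#C = refl
sumOver-∪ (true  ∷ A) (true  ∷ C) g A#C with () ← A#C here here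
sumOver-∪ (true  ∷ A) (false ∷ C) g A#C =
  trans (cong (g zero +_) (sumOver-∪ A C (g ∘ suc) (Disjoint-tail A#C)))
        (sym (+-assoc (g zero) _ _))
sumOver-∪ (false ∷ A) (true  ∷ C) g A#C =
  trans (cong (g zero +_) (sumOver-∪ A C (g ∘ suc) (Disjoint-tail A#C)))
        (x∙yz≈y∙xz (g zero) (sumOver A (g ∘ suc)) _)
sumOver-∪ (false ∷ A) (false ∷ C) g A#C = sumOver-∪ A C (g ∘ suc) (Disjoint-tail A#C)

image : (Fin m → Fin n) → Subset m → Subset n
image r []          = ⊥
image r (true  ∷ A) = ⁅ r zero ⁆ ∪ image (r ∘ suc) A
image r (false ∷ A) = image (r ∘ suc) A

∈-image⁺ : (r : Fin m → Fin n) (A : Subset m) {i : Fin m} → i ∈ A → r i ∈ image r A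
∈-image⁺ r (true  ∷ A) here        = x∈p∪q⁺ (inj₁ (x∈⁅x⁆ (r zero)))
∈-image⁺ r (true  ∷ A) (there i∈A) = x∈p∪q⁺ (inj₂ (∈-image⁺ (r ∘ suc) A i∈A))
∈-image⁺ r (false ∷ A) (there i∈A) = ∈-image⁺ (r ∘ suc) A i∈A

∈-image⁻ : (r : Fin m → Fin n) (A : Subset m) {j : Fin n} → j ∈ image r A → ∃[ i ] (i ∈ A × r i ≡ j)
∈-image⁻ r []          j∈rA = contradiction j∈rA ∉⊥
∈-image⁻ r (true  ∷ A) j∈rA with x∈p∪q⁻ ⁅ r zero ⁆ (image (r ∘ suc) A) j∈rA
... | inj₁ j∈⁅r0⁆ = zero , here , sym (x∈⁅y⁆⇒x≡y (r zero) j∈⁅r0⁆)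
... | inj₂ j∈rA′ with i , i∈A , ri≡j ← ∈-image⁻ (r ∘ suc) A j∈rA′ = suc i , there i∈A , ri≡j
∈-image⁻ r (false ∷ A) j∈rA with i , i∈A , ri≡j ← ∈-image⁻ (r ∘ suc) A j∈rA = suc i , there i∈A , ri≡j

InjectiveOn : (Fin m → Fin n) → Subset m → Set
InjectiveOn r A = ∀ {i j} → i ∈ A → j ∈ A → r i ≡ r j → i ≡ j

InjectiveOn-tail : ∀ {a} {r : Fin (ℕ.suc m) → Fin n} → InjectiveOn r (a ∷ A) → InjectiveOn (r ∘ suc) A
InjectiveOn-tail inj i∈A j∈A e = suc-injective (inj (there i∈A) (there j∈A) e)

sumOver-image : (r : Fin m → Fin n) (A : Subset m) (h : Fin n → ℕ) →
                InjectiveOn r A → sumOver (image r A) h ≡ sumOver A (h ∘ r)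
sumOver-image r []          h inj = sumOver-⊥ h
sumOver-image r (true  ∷ A) h inj = begin
  sumOver (⁅ r zero ⁆ ∪ image (r ∘ suc) A) h
    ≡⟨ sumOver-∪ ⁅ r zero ⁆ (image (r ∘ suc) A) h r0∉rA ⟩
  sumOver ⁅ r zero ⁆ h + sumOver (image (r ∘ suc) A) h
    ≡⟨ cong₂ _+_ (sumOver-⁅⁆ (r zero) h) (sumOver-image (r ∘ suc) A h (InjectiveOn-tail inj)) ⟩
  h (r zero) + sumOver A (h ∘ r ∘ suc) ∎
  where
  open ≡-Reasoning
  r0∉rA : Disjoint ⁅ r zero ⁆ (image (r ∘ suc) A)
  r0∉rA j∈⁅r0⁆ j∈rA with i , i∈A , ri≡j ← ∈-image⁻ (r ∘ suc) A j∈rA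
    with () ← inj here (there i∈A) (trans (sym (x∈⁅y⁆⇒x≡y (r zero) j∈⁅r0⁆)) (sym ri≡j))
sumOver-image r (false ∷ A) h inj = sumOver-image (r ∘ suc) A h (InjectiveOn-tail inj)

∣image∣ : (r : Fin m → Fin n) (A : Subset m) → InjectiveOn r A → ∣ image r A ∣ ≡ ∣ A ∣
∣image∣ r A inj = begin
  ∣ image r A ∣                   ≡⟨ ∣A∣≡sumOver-1 (image r A) ⟩
  sumOver (image r A) (const 1)   ≡⟨ sumOver-image r A (const 1) inj ⟩
  sumOver A (const 1)             ≡⟨ ∣A∣≡sumOver-1 A ⟨
  ∣ A ∣                           ∎
  where open ≡-Reasoning

preimage : (Fin m → Fin n) → Subset n → Subset m
preimage r S = tabulate (lookup S ∘ r)

∈-preimage⁺ : (r : Fin m → Fin n) {i : Fin m} → r i ∈ S → i ∈ preimage r S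
∈-preimage⁺ {S = S} r {i} ri∈S =
  lookup⇒[]= i (preimage r S) (trans (lookup∘tabulate (lookup S ∘ r) i) ([]=⇒lookup ri∈S))

∈-preimage⁻ : (r : Fin m → Fin n) {i : Fin m} → i ∈ preimage r S → r i ∈ S
∈-preimage⁻ {S = S} r {i} i∈r⁻¹S =
  lookup⇒[]= (r i) S (trans (sym (lookup∘tabulate (lookup S ∘ r) i)) ([]=⇒lookup i∈r⁻¹S))

image-∩-preimage : (r : Fin m → Fin n) (K : Subset m) → S ⊆ image r K → image r (K ∩ preimage r S) ≡ S
image-∩-preimage {S = S} r K S⊆rK = ⊆-antisym image⊆S S⊆image
  where
  image⊆S : image r (K ∩ preimage r S) ⊆ S
  image⊆S j∈image with i , i∈K∩r⁻¹S , refl ← ∈-image⁻ r (K ∩ preimage r S) j∈image =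
    ∈-preimage⁻ r (proj₂ (x∈p∩q⁻ K (preimage r S) i∈K∩r⁻¹S))
  S⊆image : S ⊆ image r (K ∩ preimage r S)
  S⊆image j∈S with i , i∈K , refl ← ∈-image⁻ r K (S⊆rK j∈S) =
    ∈-image⁺ r (K ∩ preimage r S) (x∈p∩q⁺ (i∈K , ∈-preimage⁺ r j∈S))

take : ℕ → Subset n → Subset n
take ℕ.zero    A           = ⊥
take (ℕ.suc k) []          = []
take (ℕ.suc k) (true  ∷ A) = true ∷ take k A
take (ℕ.suc k) (false ∷ A) = false ∷ take (ℕ.suc k) A

drop : ℕ → Subset n → Subset n
drop ℕ.zero    A           = A
drop (ℕ.suc k) []          = []
drop (ℕ.suc k) (true  ∷ A) = false ∷ drop k A
drop (ℕ.suc k) (false ∷ A) = false ∷ drop (ℕ.suc k) A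

take⊆ : ∀ k (A : Subset n) → take k A ⊆ A
take⊆ ℕ.zero    A           i∈⊥         = contradiction i∈⊥ ∉⊥
take⊆ (ℕ.suc k) (true  ∷ A) here        = here
take⊆ (ℕ.suc k) (true  ∷ A) (there i∈) = there (take⊆ k A i∈)
take⊆ (ℕ.suc k) (false ∷ A) (there i∈) = there (take⊆ (ℕ.suc k) A i∈)

drop⊆ : ∀ k (A : Subset n) → drop k A ⊆ A
drop⊆ ℕ.zero    A           i∈         = i∈
drop⊆ (ℕ.suc k) (true  ∷ A) (there i∈) = there (drop⊆ k A i∈)
drop⊆ (ℕ.suc k) (false ∷ A) (there i∈) = there (drop⊆ (ℕ.suc k) A i∈)

take-drop-disjoint : ∀ k (A : Subset n) → Disjoint (take k A) (drop k A)
take-drop-disjoint ℕ.zero    A           i∈⊥         _           = contradiction i∈⊥ ∉⊥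
take-drop-disjoint (ℕ.suc k) (true  ∷ A) (there i∈t) (there i∈d) = take-drop-disjoint k A i∈t i∈d
take-drop-disjoint (ℕ.suc k) (false ∷ A) (there i∈t) (there i∈d) = take-drop-disjoint (ℕ.suc k) A i∈t i∈d

∣take∣ : ∀ k (A : Subset n) → k ≤ ∣ A ∣ → ∣ take k A ∣ ≡ k
∣take∣ {n} ℕ.zero A           _        = ∣⊥∣≡0 n
∣take∣ (ℕ.suc k) (true  ∷ A) (s≤s k≤) = cong ℕ.suc (∣take∣ k A k≤)
∣take∣ (ℕ.suc k) (false ∷ A) k≤       = ∣take∣ (ℕ.suc k) A k≤

∣drop∣ : ∀ k (A : Subset n) → k ≤ ∣ A ∣ → k + ∣ drop k A ∣ ≡ ∣ A ∣
∣drop∣ ℕ.zero    A           _        = refl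
∣drop∣ (ℕ.suc k) (true  ∷ A) (s≤s k≤) = cong ℕ.suc (∣drop∣ k A k≤)
∣drop∣ (ℕ.suc k) (false ∷ A) k≤       = ∣drop∣ (ℕ.suc k) A k≤

∣drop∣-≥ : ∀ j k (A : Subset n) → ℕ.suc j * k ≤ ∣ A ∣ → j * k ≤ ∣ drop k A ∣
∣drop∣-≥ j k A [1+j]k≤∣A∣ = +-cancelˡ-≤ k _ _ (subst (k + j * k ≤_) (sym k+∣drop∣≡∣A∣) [1+j]k≤∣A∣)
  where
  k+∣drop∣≡∣A∣ : k + ∣ drop k A ∣ ≡ ∣ A ∣
  k+∣drop∣≡∣A∣ = ∣drop∣ k A (≤-trans (m≤m+n k (j * k)) [1+j]k≤∣A∣)

toℕ-[] : ∀ n .{{_ : NonZero n}} a → toℕ ([ n ] a) ≡ a % n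
toℕ-[] n a = toℕ-fromℕ< (m%n<n a n)

toℕ-[0] : ∀ n .{{_ : NonZero n}} → toℕ ([ n ] 0) ≡ 0
toℕ-[0] n = trans (toℕ-[] n 0) (n∣m⇒m%n≡0 0 n (n ∣0))

%-cong-+ : ∀ {a a′ b b′} d .{{_ : NonZero d}} →
           a % d ≡ a′ % d → b % d ≡ b′ % d → (a + b) % d ≡ (a′ + b′) % d
%-cong-+ {a} {a′} {b} {b′} d a≡a′ b≡b′ = begin
  (a + b) % d              ≡⟨ %-distribˡ-+ a b d ⟩
  (a % d + b % d) % d      ≡⟨ cong₂ (λ u v → (u + v) % d) a≡a′ b≡b′ ⟩
  (a′ % d + b′ % d) % d    ≡⟨ %-distribˡ-+ a′ b′ d ⟨
  (a′ + b′) % d            ∎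
  where open ≡-Reasoning

∣-resp-% : ∀ {a a′ b b′} d .{{_ : NonZero d}} →
           a % d ≡ a′ % d → b % d ≡ b′ % d → d ∣ a′ + b′ → d ∣ a + b
∣-resp-% {a} {a′} {b} {b′} d a≡a′ b≡b′ d∣a′+b′ =
  m%n≡0⇒n∣m (a + b) d (trans (%-cong-+ d a≡a′ b≡b′) (n∣m⇒m%n≡0 (a′ + b′) d d∣a′+b′))

m∣n+pred[m]*n : ∀ m .{{_ : NonZero m}} n → m ∣ n + pred m * n
m∣n+pred[m]*n m n = subst (λ k → m ∣ k * n) (sym (suc-pred m)) (m∣m*n n)

%≡-by-common-complement : ∀ {a b c} d .{{_ : NonZero d}} → d ∣ a + c → d ∣ b + c → a % d ≡ b % d
%≡-by-common-complement {a} {b} {c} d d∣a+c d∣b+c = begin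
  a % d               ≡⟨ %-remove-+ʳ a d∣b+c ⟨
  (a + (b + c)) % d   ≡⟨ cong (_% d) (x∙yz≈y∙xz a b c) ⟩
  (b + (a + c)) % d   ≡⟨ %-remove-+ʳ b d∣a+c ⟩
  b % d               ∎
  where open ≡-Reasoning

sumOver-% : (A : Subset n) (g : Fin n → ℕ) (d : ℕ) .{{_ : NonZero d}} →
            sumOver A (λ i → g i % d) % d ≡ sumOver A g % d
sumOver-% []          g d = refl
sumOver-% (true  ∷ A) g d = %-cong-+ d (m%n%n≡m%n (g zero) d) (sumOver-% A (g ∘ suc) d)
sumOver-% (false ∷ A) g d = sumOver-% A (g ∘ suc) d

Σℕ : Subset n → ℕ
Σℕ A = sumOver A toℕ

toℕ-Σ : .{{_ : NonZero n}} (A : Subset n) → toℕ (Σ A) ≡ Σℕ A % n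
toℕ-Σ {n} A = trans (toℕ-[] n _) (cong (_% n) (sumOver-elems A toℕ))

toℕ-red-Σ : ∀ {p q} .{{_ : NonZero p}} .{{_ : NonZero q}} →
            p ∣ q → (A : Subset q) → toℕ (red p (Σ A)) ≡ Σℕ A % p
toℕ-red-Σ {p} {q} p∣q A = begin
  toℕ (red p (Σ A))   ≡⟨ toℕ-[] p _ ⟩
  toℕ (Σ A) % p       ≡⟨ cong (_% p) (toℕ-Σ A) ⟩
  Σℕ A % q % p        ≡⟨ m∣n⇒o%n%m≡o%m p q (Σℕ A) p∣q ⟩
  Σℕ A % p            ∎
  where open ≡-Reasoning

Σℕ-∪-% : (A C : Subset n) (d : ℕ) .{{_ : NonZero d}} →
         Disjoint A C → Σℕ (A ∪ C) % d ≡ (Σℕ A % d + Σℕ C % d) % d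
Σℕ-∪-% A C d A#C = trans (cong (_% d) (sumOver-∪ A C toℕ A#C)) (%-distribˡ-+ (Σℕ A) (Σℕ C) d)

Complete : .{{_ : NonZero n}} → Subset n → Set
Complete {n} K = (z : Fin n) → Σ[ S ∈ Subset n ] (S ⊆ K × Σ S ≡ z)

lift-subset-sum : ∀ {p q} .{{_ : NonZero p}} (K : Subset q) →
                  InjectiveOn (red p) K → Complete (image (red p) K) →
                  (z : Fin p) → Σ[ V ∈ Subset q ] (V ⊆ K × Σℕ V % p ≡ toℕ z)
lift-subset-sum {p} {q} K injective complete z with S , S⊆rK , ΣS≡z ← complete z =
  V , p∩q⊆p K _ , (begin
    Σℕ V % p                              ≡⟨ sumOver-% V toℕ p ⟨
    sumOver V (λ i → toℕ i % p) % p       ≡⟨ cong (_% p) (sumOver-cong V (toℕ-[] p ∘ toℕ)) ⟨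
    sumOver V (toℕ ∘ red p) % p           ≡⟨ cong (_% p) (sumOver-image (red p) V toℕ injective-on-V) ⟨
    Σℕ (image (red p) V) % p              ≡⟨ cong (λ X → Σℕ X % p) (image-∩-preimage (red p) K S⊆rK) ⟩
    Σℕ S % p                              ≡⟨ toℕ-Σ S ⟨
    toℕ (Σ S)                             ≡⟨ cong toℕ ΣS≡z ⟩
    toℕ z                                 ∎)
  where
  open ≡-Reasoning
  V : Subset q
  V = K ∩ preimage (red p) S
  injective-on-V : InjectiveOn (red p) V
  injective-on-V i∈V j∈V = injective (p∩q⊆p K _ i∈V) (p∩q⊆p K _ j∈V)

module Homomorphism
  {p q k : ℕ} .{{_ : NonZero p}} .{{_ : NonZero q}} (p∣q : p ∣ q)
  (complete : (K : Subset p) → ∣ K ∣ ≡ k → Complete K)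
  (B : Subset q) (3k≤∣B∣ : 3 * k ≤ ∣ B ∣) (injective : InjectiveOn (red p) B)
  (no-bad-zero-sum : ¬ (Σ[ A ∈ Subset q ] (A ⊆ B × red p (Σ A) ≡ [ p ] 0 × Σ A ≢ [ q ] 0)))
  (f : Fin p → Fin q)
  (f-spec : (x : Fin p) → (V : Subset q) → V ⊆ B → ∣ V ∣ ≤ k → red p (Σ V) ≡ x → Σ V ≡ f x)
  where

  ∣-lift : A ⊆ B → p ∣ Σℕ A → q ∣ Σℕ A
  ∣-lift {A} A⊆B p∣ΣA = m%n≡0⇒n∣m (Σℕ A) q (begin
    Σℕ A % q        ≡⟨ toℕ-Σ A ⟨
    toℕ (Σ A)       ≡⟨ cong toℕ ΣA≡0 ⟩
    toℕ ([ q ] 0)   ≡⟨ toℕ-[0] q ⟩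
    0               ∎)
    where
    open ≡-Reasoning
    red-ΣA≡0 : red p (Σ A) ≡ [ p ] 0
    red-ΣA≡0 = toℕ-injective (trans (toℕ-red-Σ p∣q A) (trans (n∣m⇒m%n≡0 _ p p∣ΣA) (sym (toℕ-[0] p))))
    ΣA≡0 : Σ A ≡ [ q ] 0
    ΣA≡0 = decidable-stable (Σ A ≟ [ q ] 0) (λ ΣA≢0 → no-bad-zero-sum (A , A⊆B , red-ΣA≡0 , ΣA≢0))

  ∣-lift-∪ : (A C : Subset q) → A ⊆ B → C ⊆ B → Disjoint A C → p ∣ Σℕ A + Σℕ C → q ∣ Σℕ A + Σℕ C
  ∣-lift-∪ A C A⊆B C⊆B A#C =
    subst (λ n → p ∣ n → q ∣ n) (sumOver-∪ A C toℕ A#C) (∣-lift (∪-least A C A⊆B C⊆B))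

  record Representative (K : Subset q) (z : Fin p) : Set where
    field
      set      : Subset q
      set⊆K    : set ⊆ K
      sum≡z    : Σℕ set % p ≡ toℕ z
      f≡sum    : toℕ (f z) ≡ Σℕ set % q

  representative : K ⊆ B → ∣ K ∣ ≡ k → (z : Fin p) → Representative K z
  representative {K} K⊆B ∣K∣≡k z = from-lift (lift-subset-sum K injective-on-K complete-image z)
    where
    injective-on-K : InjectiveOn (red p) K
    injective-on-K i∈K j∈K = injective (K⊆B i∈K) (K⊆B j∈K)
    complete-image : Complete (image (red p) K)
    complete-image = complete _ (trans (∣image∣ (red p) K injective-on-K) ∣K∣≡k)
    from-lift : Σ[ V ∈ Subset q ] (V ⊆ K × Σℕ V % p ≡ toℕ z) → Representative K z
    from-lift (V , V⊆K , ΣV≡z) =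
      record { set = V ; set⊆K = V⊆K ; sum≡z = ΣV≡z ; f≡sum = trans (cong toℕ (sym ΣV≡fz)) (toℕ-Σ V) }
      where
      ΣV≡fz : Σ V ≡ f z
      ΣV≡fz = f-spec z V (⊆-trans V⊆K K⊆B) (subst (∣ V ∣ ≤_) ∣K∣≡k (p⊆q⇒∣p∣≤∣q∣ V⊆K))
                     (toℕ-injective (trans (toℕ-red-Σ p∣q V) ΣV≡z))

  K₁ K₂ K₃ : Subset q
  K₁ = take k B
  K₂ = take k (drop k B)
  K₃ = take k (drop k (drop k B))

  K₁⊆B : K₁ ⊆ B
  K₁⊆B = take⊆ k B
  K₂⊆B : K₂ ⊆ B
  K₂⊆B = ⊆-trans (take⊆ k _) (drop⊆ k B)
  K₃⊆B : K₃ ⊆ B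
  K₃⊆B = ⊆-trans (take⊆ k _) (⊆-trans (drop⊆ k _) (drop⊆ k B))

  ∣K₁∣ : ∣ K₁ ∣ ≡ k
  ∣K₁∣ = ∣take∣ k B (≤-trans (m≤m+n k _) 3k≤∣B∣)
  ∣K₂∣ : ∣ K₂ ∣ ≡ k
  ∣K₂∣ = ∣take∣ k _ (≤-trans (m≤m+n k _) (∣drop∣-≥ 2 k B 3k≤∣B∣))
  ∣K₃∣ : ∣ K₃ ∣ ≡ k
  ∣K₃∣ = ∣take∣ k _ (≤-trans (m≤m+n k _) (∣drop∣-≥ 1 k _ (∣drop∣-≥ 2 k B 3k≤∣B∣)))

  K₁#K₂ : Disjoint K₁ K₂
  K₁#K₂ = Disjoint-mono ⊆-refl (take⊆ k _) (take-drop-disjoint k B)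
  K₁#K₃ : Disjoint K₁ K₃
  K₁#K₃ = Disjoint-mono ⊆-refl (⊆-trans (take⊆ k _) (drop⊆ k _)) (take-drop-disjoint k B)
  K₂#K₃ : Disjoint K₂ K₃
  K₂#K₃ = Disjoint-mono ⊆-refl (take⊆ k _) (take-drop-disjoint k (drop k B))

  ≡-mod-p⇒≡-mod-q : K ⊆ B → ∣ K ∣ ≡ k → (V V′ : Subset q) → V ⊆ B → V′ ⊆ B →
                    Disjoint V K → Disjoint V′ K → Σℕ V % p ≡ Σℕ V′ % p → Σℕ V % q ≡ Σℕ V′ % q
  ≡-mod-p⇒≡-mod-q {K} K⊆B ∣K∣≡k V V′ V⊆B V′⊆B V#K V′#K V≡V′ =
    %≡-by-common-complement q (q∣U+W V V⊆B V#K refl) (q∣U+W V′ V′⊆B V′#K (sym V≡V′))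
    where
    open Representative
    c : ℕ
    c = pred p * Σℕ V
    W : Representative K ([ p ] c)
    W = representative K⊆B ∣K∣≡k ([ p ] c)
    q∣U+W : (U : Subset q) → U ⊆ B → Disjoint U K → Σℕ U % p ≡ Σℕ V % p → q ∣ Σℕ U + Σℕ (set W)
    q∣U+W U U⊆B U#K U≡V =
      ∣-lift-∪ U (set W) U⊆B (⊆-trans (set⊆K W) K⊆B) (Disjoint-mono ⊆-refl (set⊆K W) U#K)
               (∣-resp-% p U≡V (trans (sum≡z W) (toℕ-[] p c)) (m∣n+pred[m]*n p (Σℕ V)))

  additive : (x y : Fin p) → f (x +[ p ] y) ≡ f x +[ q ] f y
  additive x y = toℕ-injective (begin
    toℕ (f (x +[ p ] y))             ≡⟨ f≡sum X+Y ⟩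
    Σℕ V₃ % q                        ≡⟨ ≡-mod-p⇒≡-mod-q K₃⊆B ∣K₃∣ V₃ V₁₂ V₃⊆B V₁₂⊆B V₃#K₃ V₁₂#K₃ V₃≡V₁₂ ⟩
    Σℕ V₁₂ % q                       ≡⟨ Σℕ-∪-% V₁ V₂ q V₁#V₂ ⟩
    (Σℕ V₁ % q + Σℕ V₂ % q) % q      ≡⟨ cong₂ (λ a b → (a + b) % q) (f≡sum X) (f≡sum Y) ⟨
    (toℕ (f x) + toℕ (f y)) % q      ≡⟨ toℕ-[] q _ ⟨
    toℕ (f x +[ q ] f y)             ∎)
    where
    open ≡-Reasoning
    open Representative
    X : Representative K₁ x
    X = representative K₁⊆B ∣K₁∣ x
    Y : Representative K₂ y
    Y = representative K₂⊆B ∣K₂∣ y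
    X+Y : Representative K₁ (x +[ p ] y)
    X+Y = representative K₁⊆B ∣K₁∣ (x +[ p ] y)
    V₁ V₂ V₃ V₁₂ : Subset q
    V₁  = set X
    V₂  = set Y
    V₃  = set X+Y
    V₁₂ = V₁ ∪ V₂
    V₁#V₂ : Disjoint V₁ V₂
    V₁#V₂ = Disjoint-mono (set⊆K X) (set⊆K Y) K₁#K₂
    V₃⊆B : V₃ ⊆ B
    V₃⊆B = ⊆-trans (set⊆K X+Y) K₁⊆B
    V₁₂⊆B : V₁₂ ⊆ B
    V₁₂⊆B = ∪-least V₁ V₂ (⊆-trans (set⊆K X) K₁⊆B) (⊆-trans (set⊆K Y) K₂⊆B)
    V₃#K₃ : Disjoint V₃ K₃
    V₃#K₃ = Disjoint-mono (set⊆K X+Y) ⊆-refl K₁#K₃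
    V₁₂#K₃ : Disjoint V₁₂ K₃
    V₁₂#K₃ = Disjoint-∪ˡ V₁ V₂ (Disjoint-mono (set⊆K X) ⊆-refl K₁#K₃)
                               (Disjoint-mono (set⊆K Y) ⊆-refl K₂#K₃)
    V₃≡V₁₂ : Σℕ V₃ % p ≡ Σℕ V₁₂ % p
    V₃≡V₁₂ = begin
      Σℕ V₃ % p                      ≡⟨ sum≡z X+Y ⟩
      toℕ (x +[ p ] y)               ≡⟨ toℕ-[] p _ ⟩
      (toℕ x + toℕ y) % p            ≡⟨ cong₂ (λ a b → (a + b) % p) (sum≡z X) (sum≡z Y) ⟨
      (Σℕ V₁ % p + Σℕ V₂ % p) % p    ≡⟨ Σℕ-∪-% V₁ V₂ p V₁#V₂ ⟨
      Σℕ V₁₂ % p                     ∎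

lemma2p4 : (p k m q : ℕ) → .{{_ : NonZero p}} → .{{_ : NonZero q}} →
    Prime p → 1 ≤ k →
    ((K : Subset p) → ∣ K ∣ ≡ k → (x : Fin p) → Σ[ S ∈ Subset p ] (S ⊆ K × Σ S ≡ x)) →
    q ≡ m * p → 1 < m →
    (B : Subset q) → 4 * k < ∣ B ∣ →
    (∀ {i j} → i ∈ B → j ∈ B → red p i ≡ red p j → i ≡ j) →
    Σ[ b ∈ Fin q ] (b ∈ B × ¬ (m ∣ toℕ b)) →
    ¬ (Σ[ A ∈ Subset q ] (A ⊆ B × red p (Σ A) ≡ [ p ] 0 × Σ A ≢ [ q ] 0)) →
    (f : Fin p → Fin q) →
    ((x : Fin p) → (V : Subset q) → V ⊆ B → ∣ V ∣ ≤ k → red p (Σ V) ≡ x → Σ V ≡ f x) →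
    (x y : Fin p) → f (x +[ p ] y) ≡ (f x +[ q ] f y)
lemma2p4 p k m q _ _ complete q≡m*p _ B 4k<∣B∣ injective _ no-bad-zero-sum f f-spec =
  Homomorphism.additive (divides m q≡m*p) complete B 3k≤∣B∣ injective no-bad-zero-sum f f-spec
  where
  3k≤∣B∣ : 3 * k ≤ ∣ B ∣
  3k≤∣B∣ = ≤-trans (*-monoˡ-≤ k (n≤1+n 3)) (<⇒≤ 4k<∣B∣)
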